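{- Let $P$ be a poset and let $X$ be a coherent cutset of $P$. Let $\Gamma_f(P,X)$ be the subposet of $\Gamma(P,X)$ whose elements are the connected components of the non-empty sets $\textnormal{st}_P(A)$ with $A$ a finite non-empty subset of $X$. Then: (a) $\Gamma_f(P,X)=\{\textnormal{st}_P(A) \mid A \textnormal{ is a finite non-empty astral subset of }X\}$; (b) for each $C\in \Gamma_f(P,X)$ there exists $z\in C$ such that $C=\textnormal{st}_C(z)$; in particular, the elements of $\Gamma_f(P,X)$ are contractible subspaces of $P$.
   Context: For a poset $P$ and $a\in P$, $\textnormal{st}_P(a)=\{x\in P\mid x\leq a \text{ or } x\geq a\}$; for non-empty $A\subseteq P$, $\textnormal{st}_P(A)=\bigcap_{a\in A}\textnormal{st}_P(a)$; $\textnormal{st}_C(z)$ is the star computed inside the subposet $C$. A subset $A\subseteq P$ is astral if $A\subseteq\textnormal{st}_P(x)$ for some $x\in P$; bounded if it is bounded above or below. $X\subseteq P$ is a cutset if for every finite chain $\sigma$ of $P$ there is $a\in X$ with $\sigma\cup\{a\}$ a chain; it is coherent if every finite non-empty bounded subset of $X$ has a meet or a join in $P$. The crosscut poset $\Gamma(P,X)$ is the set of connected components (w.r.t. comparability) of the non-empty subposets $\textnormal{st}_P(A)$, $A$ a non-empty subset of $X$, ordered by inclusion. Posets are topological spaces via the Alexandroff topology whose open sets are the down-sets. -}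

module Defs where

open import Level using (Level; _⊔_)
open import Data.Product using (Σ; ∃; _×_; _,_)
open import Data.Sum using (_⊎_)
open import Data.List using (List; []; _∷_)
open import Data.List.NonEmpty using (List⁺; toList)
open import Data.List.Relation.Unary.All using (All)
open import Relation.Binary.Bundles using (Poset)
open import Relation.Unary using (Pred; _≐_)

module _ {c ℓ₁ ℓ₂ : Level} (P : Poset c ℓ₁ ℓ₂) where
  open Poset P

  Comparable : Carrier → Carrier → Set ℓ₂
  Comparable x y = (x ≤ y) ⊎ (y ≤ x)

  st : Carrier → Pred Carrier ℓ₂
  st a x = Comparable x a

  -- st_P(A) for a finite non-empty A (given as a non-empty list)
  stL : List⁺ Carrier → Pred Carrier (c ⊔ ℓ₂)
  stL A x = All (λ a → Comparable x a) (toList A)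

  stIn : {ℓ : Level} → Pred Carrier ℓ → Carrier → Pred Carrier (ℓ ⊔ ℓ₂)
  stIn C z x = C x × Comparable x z

  Astral : List⁺ Carrier → Set (c ⊔ ℓ₂)
  Astral A = ∃ λ x → All (λ a → Comparable a x) (toList A)

  IsChain : List Carrier → Set (c ⊔ ℓ₂)
  IsChain σ = All (λ a → All (λ b → Comparable a b) σ) σ

  Cutset : {ℓ : Level} → Pred Carrier ℓ → Set (c ⊔ ℓ ⊔ ℓ₂)
  Cutset X = (σ : List Carrier) → IsChain σ →
             ∃ λ a → X a × IsChain (a ∷ σ)

  BoundedAbove BoundedBelow Bounded : List⁺ Carrier → Set (c ⊔ ℓ₂)
  BoundedAbove A = ∃ λ u → All (λ a → a ≤ u) (toList A)
  BoundedBelow A = ∃ λ l → All (λ a → l ≤ a) (toList A)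
  Bounded A = BoundedAbove A ⊎ BoundedBelow A

  IsMeet : List⁺ Carrier → Carrier → Set (c ⊔ ℓ₂)
  IsMeet A m = All (λ a → m ≤ a) (toList A) ×
               ((y : Carrier) → All (λ a → y ≤ a) (toList A) → y ≤ m)

  IsJoin : List⁺ Carrier → Carrier → Set (c ⊔ ℓ₂)
  IsJoin A j = All (λ a → a ≤ j) (toList A) ×
               ((y : Carrier) → All (λ a → a ≤ y) (toList A) → j ≤ y)

  Coherent : {ℓ : Level} → Pred Carrier ℓ → Set (c ⊔ ℓ ⊔ ℓ₂)
  Coherent X = (A : List⁺ Carrier) → All X (toList A) → Bounded A →
               (∃ λ m → IsMeet A m) ⊎ (∃ λ j → IsJoin A j)

  data Zig {ℓ : Level} (S : Pred Carrier ℓ) : Carrier → Carrier → Set (c ⊔ ℓ ⊔ ℓ₂) where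
    zig-refl : ∀ {x} → Zig S x x
    zig-step : ∀ {x y z} → S y → Comparable x y → Zig S y z → Zig S x z

  Component : {ℓ : Level} → Pred Carrier ℓ → Carrier → Pred Carrier (c ⊔ ℓ ⊔ ℓ₂)
  Component S x y = S y × Zig S x y

  InΓf : {ℓ ℓ' : Level} → Pred Carrier ℓ → Pred Carrier ℓ' → Set (c ⊔ ℓ ⊔ ℓ' ⊔ ℓ₂)
  InΓf X C = ∃ λ (A : List⁺ Carrier) → All X (toList A) ×
             (∃ λ x → stL A x × (C ≐ Component (stL A) x))

-- If x ∈ st(A), split A into the elements A⁺ above x and A⁻ below x. When A⁻ is
-- empty, A is bounded below by x; otherwise A⁻ is bounded above by x. Either way
-- coherence gives a meet or join z of that part, and z is comparable with every
-- element of st(A). So st(A) is a cone with apex z: it is connected, hence equal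
-- to each of its components, and it is non-empty exactly when A is astral.
{-# OPTIONS --safe #-}
module Submission where

open import Defs
open import Level using (Level; _⊔_)
open import Function using (_∘_; flip; id)
open import Data.Product using (∃; _×_; _,_; proj₁; proj₂)
import Data.Product as Product
open import Data.Sum using (_⊎_; inj₁; inj₂; [_,_]′)
import Data.Sum as Sum
open import Data.List using (List; []; _∷_)
open import Data.List.NonEmpty using (List⁺; toList; _∷_)
open import Data.List.Membership.Propositional using (_∈_)
open import Data.List.Relation.Binary.Subset.Propositional using (_⊆_)
open import Data.List.Relation.Unary.All as All using (All; []; _∷_)
open import Data.List.Relation.Unary.All.Properties using (anti-mono)
open import Data.List.Relation.Unary.Any using (Any; here; there)
open import Relation.Binary.Bundles using (Poset)
open import Relation.Binary.PropositionalEquality using (refl)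
open import Relation.Unary using (Pred; _≐_)
open import Relation.Unary.Properties using (≐-sym; ≐-trans)

all-or-any : ∀ {a p q} {A : Set a} {P : Pred A p} {Q : Pred A q} {xs : List A} →
             All (λ x → P x ⊎ Q x) xs → All P xs ⊎ Any Q xs
all-or-any [] = inj₁ []
all-or-any (inj₁ px ∷ pqs) = Sum.map (px ∷_) there (all-or-any pqs)
all-or-any (inj₂ qx ∷ _) = inj₂ (here qx)

module _ {c ℓ₁ ℓ₂ : Level} (P : Poset c ℓ₁ ℓ₂) where
  open Poset P using (Carrier; _≤_; trans)

  IsConePoint : {ℓ : Level} → Pred Carrier ℓ → Carrier → Set (c ⊔ ℓ ⊔ ℓ₂)
  IsConePoint S z = S z × (∀ {y} → S y → Comparable P y z)

  IsExtremum : List⁺ Carrier → Carrier → Set (c ⊔ ℓ₂)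
  IsExtremum B z = IsMeet P B z ⊎ IsJoin P B z

  meet-isConePoint : ∀ {B m} → IsMeet P B m → IsConePoint (stL P B) m
  meet-isConePoint {B} {m} (m≤B , greatest) = All.map inj₁ m≤B , comparable
    where
    comparable : ∀ {y} → stL P B y → Comparable P y m
    comparable y~B with all-or-any y~B
    ... | inj₁ y≤B = inj₁ (greatest _ y≤B)
    ... | inj₂ some≤y = inj₂ (All.lookupWith trans m≤B some≤y)

  join-isConePoint : ∀ {B j} → IsJoin P B j → IsConePoint (stL P B) j
  join-isConePoint {B} {j} (B≤j , least) = All.map inj₂ B≤j , comparable
    where
    comparable : ∀ {y} → stL P B y → Comparable P y j
    comparable y~B with all-or-any (All.map Sum.swap y~B)
    ... | inj₁ B≤y = inj₂ (least _ B≤y)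
    ... | inj₂ y≤some = inj₁ (All.lookupWith (flip trans) B≤j y≤some)

  extremum-isConePoint : ∀ {B z} → IsExtremum B z → IsConePoint (stL P B) z
  extremum-isConePoint = [ meet-isConePoint , join-isConePoint ]′

  extremum-≤-upperBound : ∀ {B z x} → IsExtremum B z → All (_≤ x) (toList B) → z ≤ x
  extremum-≤-upperBound {_ ∷ _} (inj₁ (z≤b ∷ _ , _)) (b≤x ∷ _) = trans z≤b b≤x
  extremum-≤-upperBound (inj₂ (_ , least)) B≤x = least _ B≤x

  lowerPart : ∀ {x} as → All (Comparable P x) as →
              ∃ λ bs → bs ⊆ as × All (_≤ x) bs × (∀ {a} → a ∈ as → x ≤ a ⊎ a ∈ bs)
  lowerPart [] [] = [] , (λ ()) , [] , λ ()
  lowerPart (a ∷ as) (x~a ∷ x~as) with lowerPart as x~as | x~a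
  ... | bs , bs⊆as , bs≤x , cover | inj₁ x≤a =
    bs , there ∘ bs⊆as , bs≤x , λ { (here refl) → inj₁ x≤a ; (there a∈as) → cover a∈as }
  ... | bs , bs⊆as , bs≤x , cover | inj₂ a≤x =
    a ∷ bs ,
    (λ { (here refl) → here refl ; (there b∈bs) → there (bs⊆as b∈bs) }) ,
    a≤x ∷ bs≤x ,
    λ { (here refl) → inj₂ (here refl) ; (there a∈as) → Sum.map₂ there (cover a∈as) }

  isConePoint-extend : ∀ {A B x z} → toList B ⊆ toList A →
                       (∀ {a} → a ∈ toList A → x ≤ a ⊎ a ∈ toList B) → z ≤ x →
                       IsConePoint (stL P B) z → IsConePoint (stL P A) z
  isConePoint-extend {A} {z = z} B⊆A cover z≤x (z∈stB , cone) = z∈stA , cone ∘ anti-mono B⊆A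
    where
    z∈stA : stL P A z
    z∈stA = All.tabulate λ a∈A →
      [ (λ x≤a → inj₁ (trans z≤x x≤a)) , All.lookup z∈stB ]′ (cover a∈A)

  isConePoint⇒connected : ∀ {ℓ} {S : Pred Carrier ℓ} {z x y} →
                          IsConePoint S z → S x → S y → Zig P S x y
  isConePoint⇒connected (z∈S , cone) x∈S y∈S =
    zig-step z∈S (cone x∈S) (zig-step y∈S (Sum.swap (cone y∈S)) zig-refl)

  component-of-cone : ∀ {ℓ} {S : Pred Carrier ℓ} {z x} →
                      IsConePoint S z → S x → Component P S x ≐ S
  component-of-cone cone x∈S = proj₁ , λ y∈S → y∈S , isConePoint⇒connected cone x∈S y∈S

  isConePoint-resp-≐ : ∀ {ℓ ℓ'} {S : Pred Carrier ℓ} {C : Pred Carrier ℓ'} {z} →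
                       C ≐ S → IsConePoint S z → IsConePoint C z
  isConePoint-resp-≐ (C⊆S , S⊆C) (z∈S , cone) = S⊆C z∈S , cone ∘ C⊆S

  isConePoint⇒≐stIn : ∀ {ℓ} {C : Pred Carrier ℓ} {z} → IsConePoint C z → C ≐ stIn P C z
  isConePoint⇒≐stIn (_ , cone) = (λ y∈C → y∈C , cone y∈C) , proj₁

  astral⇒stL-nonempty : ∀ {A} → Astral P A → ∃ (stL P A)
  astral⇒stL-nonempty = Product.map₂ (All.map Sum.swap)

  stL-nonempty⇒astral : ∀ {A} → ∃ (stL P A) → Astral P A
  stL-nonempty⇒astral = Product.map₂ (All.map Sum.swap)

  module _ {ℓ : Level} {X : Pred Carrier ℓ} (coherent : Coherent P X) where

    coherent-extremum : ∀ {B} → All X (toList B) → Bounded P B → ∃ (IsExtremum B)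
    coherent-extremum {B} B⊆X bounded =
      [ Product.map₂ inj₁ , Product.map₂ inj₂ ]′ (coherent B B⊆X bounded)

    stL-hasConePoint : ∀ {A x} → All X (toList A) → stL P A x → ∃ (IsConePoint (stL P A))
    stL-hasConePoint {A} {x} A⊆X x∈st with lowerPart (toList A) x∈st
    ... | [] , _ , _ , cover =
      Product.map₂ extremum-isConePoint (coherent-extremum A⊆X (inj₂ (x , All.tabulate x≤)))
      where
      x≤ : ∀ {a} → a ∈ toList A → x ≤ a
      x≤ a∈A = [ id , (λ ()) ]′ (cover a∈A)
    ... | b ∷ bs , B⊆A , B≤x , cover
      with coherent-extremum (anti-mono B⊆A A⊆X) (inj₁ (x , B≤x))
    ... | z , extremum =
      z , isConePoint-extend B⊆A cover (extremum-≤-upperBound extremum B≤x)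
                             (extremum-isConePoint extremum)

    component≐stL : ∀ {A x} → All X (toList A) → stL P A x → Component P (stL P A) x ≐ stL P A
    component≐stL A⊆X x∈st = component-of-cone (proj₂ (stL-hasConePoint A⊆X x∈st)) x∈st

    module _ {ℓC : Level} {C : Pred Carrier ℓC} where

      InΓf⇒astral-star : InΓf P X C →
                         ∃ λ A → All X (toList A) × Astral P A × (C ≐ stL P A)
      InΓf⇒astral-star (A , A⊆X , x , x∈st , C≐component) =
        A , A⊆X , stL-nonempty⇒astral (x , x∈st) , ≐-trans C≐component (component≐stL A⊆X x∈st)

      astral-star⇒InΓf : (∃ λ A → All X (toList A) × Astral P A × (C ≐ stL P A)) →
                         InΓf P X C
      astral-star⇒InΓf (A , A⊆X , astral , C≐st) =
        let x , x∈st = astral⇒stL-nonempty astral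
        in A , A⊆X , x , x∈st , ≐-trans C≐st (≐-sym (component≐stL A⊆X x∈st))

      InΓf-hasConePoint : InΓf P X C → ∃ (IsConePoint C)
      InΓf-hasConePoint Γ =
        let A , A⊆X , astral , C≐st = InΓf⇒astral-star Γ
            z , cone = stL-hasConePoint A⊆X (proj₂ (astral⇒stL-nonempty astral))
        in z , isConePoint-resp-≐ C≐st cone

proposition3p14 : {c ℓ₁ ℓ₂ ℓ ℓC : Level} (P : Poset c ℓ₁ ℓ₂) (X : Pred (Poset.Carrier P) ℓ) →
    Cutset P X → Coherent P X →
    ((C : Pred (Poset.Carrier P) ℓC) →
      (InΓf P X C → ∃ λ (A : List⁺ (Poset.Carrier P)) → All X (toList A) × Astral P A × (C ≐ stL P A))
      × ((∃ λ (A : List⁺ (Poset.Carrier P)) → All X (toList A) × Astral P A × (C ≐ stL P A)) → InΓf P X C))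
    × ((C : Pred (Poset.Carrier P) ℓC) →
      InΓf P X C → ∃ λ z → C z × (C ≐ stIn P C z))
proposition3p14 P X _ coherent =
  (λ C → InΓf⇒astral-star P coherent , astral-star⇒InΓf P coherent) ,
  λ C Γ → let z , cone = InΓf-hasConePoint P coherent Γ
          in z , proj₁ cone , isConePoint⇒≐stIn P cone
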